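{- Let $m,n$ be positive integers and let $\delta,\delta'$ be sum-labelings of $\Gamma_{(m,n)}$ with $\delta\subsetneq\delta'$. If $\mathcal{R}(\delta)=\omega$, then $\mathcal{R}(\delta')>\omega$.
   Context: An $m\times n$ partial alternating sign matrix (PASM) is an $m\times n$ matrix $M$ with entries in $\{ -1,0,1\}$ all of whose column partial sums $\sum_{i'=1}^{i}M_{i'j}$ and row partial sums $\sum_{j'=1}^{j}M_{ij'}$ ($1\le i\le m$, $1\le j\le n$) lie in $\{0,1\}$. The grid graph $\Gamma_{(m,n)}$ has vertices $(i,j)$, $1\le i\le m+1$, $1\le j\le n+1$; vertices with $i=m+1$ or $j=n+1$ are boundary vertices. Its edges are, for $1\le i\le m$, $1\le j\le n$: $(i,j)$–$(i,j+1)$ and $(i,j)$–$(i+1,j)$; it is drawn in the plane as a grid with $(i,j)$ in row $i$ and column $j$. The basic sum-labeling $g(M)$ of a PASM $M$ labels $(i,j)$–$(i,j+1)$ by $\sum_{j'=1}^{j}M_{ij'}$ and $(i,j)$–$(i+1,j)$ by $\sum_{i'=1}^{i}M_{i'j}$. Labels are viewed as sets ($0\leftrightarrow\{0\}$, $1\leftrightarrow\{1\}$); union of labelings is edgewise union; $\delta\subseteq\delta'$ means edgewise inclusion of labels, and $\subsetneq$ means $\subseteq$ and $\neq$. A sum-labeling is either the empty labeling $\emptyset$ (contained in every sum-labeling) or a union of a nonempty set of basic sum-labelings. For a nonempty sum-labeling $\delta$, let $G$ be the plane graph formed by edges labeled $\{0,1\}$ and their endpoints, with all boundary vertices identified to a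 single point in the exterior of the grid; a region is a face of $G$ other than the exterior one, and $\mathcal{R}(\delta)$ is the number of regions; $\mathcal{R}(\emptyset)=-1$. -}

module Defs where

open import Data.Nat using (ℕ; zero; suc)
open import Data.Nat.Properties using (_≤?_)
open import Data.Fin using (Fin; toℕ) renaming (zero to fzero; suc to fsuc)
open import Data.Integer using (ℤ; +_; -[1+_]; _+_)
open import Data.Bool using (if_then_else_)
open import Data.List using (List)
open import Data.List.NonEmpty using (List⁺; toList)
open import Data.List.Membership.Propositional using (_∈_)
open import Data.Product using (Σ; ∃; _×_; _,_)
open import Data.Sum using (_⊎_)
open import Data.Empty using (⊥)
open import Relation.Nullary using (¬_)
open import Relation.Nullary.Decidable using (⌊_⌋)
open import Relation.Binary.PropositionalEquality using (_≡_)
open import Relation.Binary.Construct.Closure.ReflexiveTransitive using (Star)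
open import Relation.Binary.Construct.Closure.Symmetric using (SymClosure)

-- Matrices, indices are 0-based: (i : Fin m) stands for row i+1.

Matrix : ℕ → ℕ → Set
Matrix m n = Fin m → Fin n → ℤ

sumFin : ∀ {k} → (Fin k → ℤ) → ℤ
sumFin {zero}  f = + 0
sumFin {suc k} f = f fzero + sumFin (λ x → f (fsuc x))

rowPS : ∀ {m n} → Matrix m n → Fin m → Fin n → ℤ
rowPS M i j = sumFin (λ j' → if ⌊ toℕ j' ≤? toℕ j ⌋ then M i j' else + 0)

colPS : ∀ {m n} → Matrix m n → Fin m → Fin n → ℤ
colPS M i j = sumFin (λ i' → if ⌊ toℕ i' ≤? toℕ i ⌋ then M i' j else + 0)

In01 : ℤ → Set
In01 x = (x ≡ + 0) ⊎ (x ≡ + 1)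

InSign : ℤ → Set
InSign x = (x ≡ -[1+ 0 ]) ⊎ In01 x

IsPASM : ∀ {m n} → Matrix m n → Set
IsPASM {m} {n} M = (∀ i j → InSign (M i j))
                 × (∀ i j → In01 (rowPS M i j))
                 × (∀ i j → In01 (colPS M i j))

PASM : ℕ → ℕ → Set
PASM m n = Σ (Matrix m n) IsPASM

-- Edges of the grid graph Γ_(m,n).
--   hor i j : the edge (i+1, j+1) – (i+1, j+2)   (1-based vertices)
--   ver i j : the edge (i+1, j+1) – (i+2, j+1)

data Edge (m n : ℕ) : Set where
  hor : Fin m → Fin n → Edge m n
  ver : Fin m → Fin n → Edge m n

Labeling : ℕ → ℕ → Set₁
Labeling m n = Edge m n → ℤ → Set

gval : ∀ {m n} → Matrix m n → Edge m n → ℤ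
gval M (hor i j) = rowPS M i j
gval M (ver i j) = colPS M i j

basic : ∀ {m n} → PASM m n → Labeling m n
basic (M , _) e x = x ≡ gval M e

unionBasic : ∀ {m n} → List⁺ (PASM m n) → Labeling m n
unionBasic Ms e x = ∃ λ M → (M ∈ toList Ms) × basic M e x

emptyLab : ∀ {m n} → Labeling m n
emptyLab e x = ⊥

_⊆L_ : ∀ {m n} → Labeling m n → Labeling m n → Set
δ ⊆L δ' = ∀ e x → δ e x → δ' e x

_≈L_ : ∀ {m n} → Labeling m n → Labeling m n → Set
δ ≈L δ' = (δ ⊆L δ') × (δ' ⊆L δ)

_⊊L_ : ∀ {m n} → Labeling m n → Labeling m n → Set
δ ⊊L δ' = (δ ⊆L δ') × ¬ (δ ≈L δ')

IsSumLabeling : ∀ {m n} → Labeling m n → Set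
IsSumLabeling {m} {n} δ =
  (δ ≈L emptyLab) ⊎ (Σ (List⁺ (PASM m n)) λ Ms → δ ≈L unionBasic Ms)

InG : ∀ {m n} → Labeling m n → Edge m n → Set
InG δ e = δ e (+ 0) × δ e (+ 1)

-- Faces of the full grid drawing (with boundary vertices identified to one
-- exterior point): the exterior face, and the m·n cells; cell i j is the
-- face whose top-left corner is the vertex (i+1, j+1).
data Cell (m n : ℕ) : Set where
  ext  : Cell m n
  cell : Fin m → Fin n → Cell m n

data Adj {m n} (δ : Labeling m n) : Cell m n → Cell m n → Set where
  right : ∀ i j j' → toℕ j' ≡ suc (toℕ j) → ¬ InG δ (ver i j')
        → Adj δ (cell i j) (cell i j')
  down  : ∀ i i' j → toℕ i' ≡ suc (toℕ i) → ¬ InG δ (hor i' j)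
        → Adj δ (cell i j) (cell i' j)
  top   : ∀ i j → toℕ i ≡ 0 → ¬ InG δ (hor i j) → Adj δ ext (cell i j)
  left  : ∀ i j → toℕ j ≡ 0 → ¬ InG δ (ver i j) → Adj δ ext (cell i j)

SameFace : ∀ {m n} → Labeling m n → Cell m n → Cell m n → Set
SameFace δ = Star (SymClosure (Adj δ))

-- G has exactly k+1 faces (k regions plus the exterior face): a surjective
-- classification of cells into k+1 classes whose fibres are the faces.
HasFaces : ∀ {m n} → Labeling m n → ℕ → Set
HasFaces {m} {n} δ k =
  Σ (Cell m n → Fin (suc k)) λ f →
    (∀ y → ∃ λ c → f c ≡ y) ×
    (∀ c c' → (f c ≡ f c' → SameFace δ c c') × (SameFace δ c c' → f c ≡ f c'))

RegionCount : ∀ {m n} → Labeling m n → ℤ → Set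
RegionCount δ ω =
  ((δ ≈L emptyLab) × (ω ≡ -[1+ 0 ]))
  ⊎ ((¬ (δ ≈L emptyLab)) × (Σ ℕ λ k → (ω ≡ + k) × HasFaces δ k))

-- Give each cell of the grid the potential of a PASM M: the sum of M over the
-- rectangle above and to the left of it, and 0 for the exterior face. Crossing
-- an edge changes the potential by the label of that edge in g(M). If M and M'
-- both occur in a sum-labeling δ', they agree on every edge outside G(δ'), so
-- the difference of their potentials is constant on each face of G(δ'); taking
-- M and M' labelling an edge of G(δ') by 0 and 1, the two cells on either side
-- of that edge lie in different faces. If δ ⊊ δ', some edge receives a new
-- label, so it lies in G(δ') but not in G(δ). The faces of G(δ') refine those
-- of G(δ), and the two cells at that edge are merged in G(δ) but separated in
-- G(δ'), so G(δ') has strictly more faces.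
module Submission where

open import Defs
open import Data.Nat using (ℕ; _≤_)
open import Data.Integer using (ℤ; _<_)
open import Data.Nat as ℕ using (zero; suc)
import Data.Nat.Properties as ℕ
open import Data.Integer using (+_; _+_; _-_; -<+; +<+)
import Data.Integer.Properties as ℤ
open import Data.Integer.Tactic.RingSolver using (solve-∀)
open import Data.Fin using (Fin; toℕ; inject₁; punchOut) renaming (zero to fzero; suc to fsuc)
import Data.Fin.Properties as Fin
open import Data.Bool using (Bool; true; false; if_then_else_)
open import Data.List.NonEmpty using (List⁺; toList; _∷_)
open import Data.List.Membership.Propositional using (_∈_; find; lose)
open import Data.List.Relation.Unary.Any using (any?; here)
open import Data.Product using (Σ; ∃; _×_; _,_; proj₁; proj₂)
import Data.Product as Product
open import Data.Sum using (inj₁; inj₂)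
open import Data.Empty using (⊥-elim)
open import Function using (_∘_)
open import Function.Definitions using (Injective)
open import Relation.Nullary using (¬_; Dec; yes; no)
open import Relation.Nullary.Decidable using (⌊_⌋; decidable-stable)
open import Relation.Binary.PropositionalEquality
open import Relation.Binary.Construct.Closure.ReflexiveTransitive using (ε; _◅_)
import Relation.Binary.Construct.Closure.ReflexiveTransitive as Star
open import Relation.Binary.Construct.Closure.Symmetric using (fwd; bwd)
import Relation.Binary.Construct.Closure.Symmetric as SymClosure
open import Algebra.Properties.CommutativeSemigroup ℤ.+-commutativeSemigroup using (interchange)

open ≡-Reasoning

sumFin-cong : ∀ {k} {f g : Fin k → ℤ} → (∀ a → f a ≡ g a) → sumFin f ≡ sumFin g
sumFin-cong {zero}  f≗g = refl
sumFin-cong {suc k} f≗g = cong₂ _+_ (f≗g fzero) (sumFin-cong (f≗g ∘ fsuc))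

sumFin-zeros : ∀ k → sumFin {k} (λ _ → + 0) ≡ + 0
sumFin-zeros zero    = refl
sumFin-zeros (suc k) = trans (ℤ.+-identityˡ _) (sumFin-zeros k)

sumFin-+ : ∀ {k} (f g : Fin k → ℤ) → sumFin (λ a → f a + g a) ≡ sumFin f + sumFin g
sumFin-+ {zero}  f g = refl
sumFin-+ {suc k} f g = begin
  (f fzero + g fzero) + sumFin (λ a → f (fsuc a) + g (fsuc a))
    ≡⟨ cong (_+_ (f fzero + g fzero)) (sumFin-+ (f ∘ fsuc) (g ∘ fsuc)) ⟩
  (f fzero + g fzero) + (sumFin (f ∘ fsuc) + sumFin (g ∘ fsuc))
    ≡⟨ interchange (f fzero) (g fzero) _ _ ⟩
  sumFin f + sumFin g ∎

sumFin-swap : ∀ {k l} (F : Fin k → Fin l → ℤ) →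
  sumFin (λ a → sumFin (F a)) ≡ sumFin (λ b → sumFin (λ a → F a b))
sumFin-swap {zero}  {l} F = sym (sumFin-zeros l)
sumFin-swap {suc k}     F = begin
  sumFin (F fzero) + sumFin (λ a → sumFin (F (fsuc a)))
    ≡⟨ cong (_+_ (sumFin (F fzero))) (sumFin-swap (F ∘ fsuc)) ⟩
  sumFin (F fzero) + sumFin (λ b → sumFin (λ a → F (fsuc a) b))
    ≡⟨ sumFin-+ (F fzero) (λ b → sumFin (λ a → F (fsuc a) b)) ⟨
  sumFin (λ b → sumFin (λ a → F a b)) ∎

if-sumFin : ∀ {k} (c : Bool) (g : Fin k → ℤ) →
  (if c then sumFin g else + 0) ≡ sumFin (λ b → if c then g b else + 0)
if-sumFin     true  g = refl
if-sumFin {k} false g = sym (sumFin-zeros k)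

if-if-comm : (c d : Bool) (x : ℤ) →
  (if c then (if d then x else + 0) else + 0) ≡ (if d then (if c then x else + 0) else + 0)
if-if-comm true  true  x = refl
if-if-comm true  false x = refl
if-if-comm false true  x = refl
if-if-comm false false x = refl

colPS-rowPS-comm : ∀ {m n} (M : Matrix m n) i j → colPS (rowPS M) i j ≡ rowPS (colPS M) i j
colPS-rowPS-comm {m} {n} M i j = begin
  sumFin (λ a → if a≤i a then sumFin (λ b → if b≤j b then M a b else + 0) else + 0)
    ≡⟨ sumFin-cong (λ a → if-sumFin {n} (a≤i a) _) ⟩
  sumFin (λ a → sumFin (λ b → if a≤i a then (if b≤j b then M a b else + 0) else + 0))
    ≡⟨ sumFin-cong (λ a → sumFin-cong (λ b → if-if-comm (a≤i a) (b≤j b) (M a b))) ⟩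
  sumFin (λ a → sumFin (λ b → if b≤j b then (if a≤i a then M a b else + 0) else + 0))
    ≡⟨ sumFin-swap {m} {n} _ ⟩
  sumFin (λ b → sumFin (λ a → if b≤j b then (if a≤i a then M a b else + 0) else + 0))
    ≡⟨ sumFin-cong (λ b → if-sumFin {m} (b≤j b) _) ⟨
  sumFin (λ b → if b≤j b then sumFin (λ a → if a≤i a then M a b else + 0) else + 0) ∎
  where
  a≤i : Fin m → Bool
  a≤i a = ⌊ toℕ a ℕ.≤? toℕ i ⌋
  b≤j : Fin n → Bool
  b≤j b = ⌊ toℕ b ℕ.≤? toℕ j ⌋

-- colPS N i j and rowPS M i j unfold to prefixSum (λ a → N a j) (toℕ i)
-- and prefixSum (M i) (toℕ j).
prefixSum : ∀ {k} → (Fin k → ℤ) → ℕ → ℤ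
prefixSum f t = sumFin (λ a → if ⌊ toℕ a ℕ.≤? t ⌋ then f a else + 0)

≤?-suc : ∀ m t → ⌊ suc m ℕ.≤? suc t ⌋ ≡ ⌊ m ℕ.≤? t ⌋
≤?-suc m t with suc m ℕ.≤? suc t | m ℕ.≤? t
... | yes _       | yes _   = refl
... | no  1+m≰1+t | yes m≤t = ⊥-elim (1+m≰1+t (ℕ.s≤s m≤t))
... | yes 1+m≤1+t | no  m≰t = ⊥-elim (m≰t (ℕ.s≤s⁻¹ 1+m≤1+t))
... | no  _       | no  _   = refl

prefixSum-first : ∀ {k} (f : Fin k → ℤ) (x : Fin k) → toℕ x ≡ 0 → prefixSum f (toℕ x) ≡ f x
prefixSum-first {suc k} f fzero refl = begin
  f fzero + sumFin {k} (λ _ → + 0) ≡⟨ cong (_+_ (f fzero)) (sumFin-zeros k) ⟩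
  f fzero + + 0                    ≡⟨ ℤ.+-identityʳ (f fzero) ⟩
  f fzero                          ∎

prefixSum-suc : ∀ {k} (f : Fin (suc k) → ℤ) t →
  prefixSum f (suc t) ≡ f fzero + prefixSum (f ∘ fsuc) t
prefixSum-suc f t = cong (_+_ (f fzero))
  (sumFin-cong (λ a → cong (λ b → if b then f (fsuc a) else + 0) (≤?-suc (toℕ a) t)))

prefixSum-step : ∀ {k} (f : Fin k → ℤ) (x : Fin k) t → toℕ x ≡ suc t →
  prefixSum f (toℕ x) ≡ prefixSum f t + f x
prefixSum-step f (fsuc fzero) zero refl = begin
  prefixSum f 1                           ≡⟨ prefixSum-suc f 0 ⟩
  f fzero + prefixSum (f ∘ fsuc) 0        ≡⟨ cong (_+_ (f fzero)) (prefixSum-first (f ∘ fsuc) fzero refl) ⟩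
  f fzero + f (fsuc fzero)                ≡⟨ cong (λ z → z + f (fsuc fzero)) (prefixSum-first f fzero refl) ⟨
  prefixSum f 0 + f (fsuc fzero)          ∎
prefixSum-step f (fsuc (fsuc y)) (suc t) refl = begin
  prefixSum f (suc (suc t))
    ≡⟨ prefixSum-suc f (suc t) ⟩
  f fzero + prefixSum (f ∘ fsuc) (suc t)
    ≡⟨ cong (_+_ (f fzero)) (prefixSum-step (f ∘ fsuc) (fsuc y) t refl) ⟩
  f fzero + (prefixSum (f ∘ fsuc) t + f (fsuc (fsuc y)))
    ≡⟨ ℤ.+-assoc (f fzero) _ _ ⟨
  (f fzero + prefixSum (f ∘ fsuc) t) + f (fsuc (fsuc y))
    ≡⟨ cong (λ z → z + f (fsuc (fsuc y))) (prefixSum-suc f t) ⟨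
  prefixSum f (suc t) + f (fsuc (fsuc y)) ∎

colPS-first : ∀ {m n} (N : Matrix m n) i j → toℕ i ≡ 0 → colPS N i j ≡ N i j
colPS-first N i j = prefixSum-first (λ a → N a j) i

rowPS-first : ∀ {m n} (M : Matrix m n) i j → toℕ j ≡ 0 → rowPS M i j ≡ M i j
rowPS-first M i = prefixSum-first (M i)

colPS-step : ∀ {m n} (N : Matrix m n) i i' j → toℕ i' ≡ suc (toℕ i) →
  colPS N i' j ≡ colPS N i j + N i' j
colPS-step N i i' j = prefixSum-step (λ a → N a j) i' (toℕ i)

rowPS-step : ∀ {m n} (M : Matrix m n) i j j' → toℕ j' ≡ suc (toℕ j) →
  rowPS M i j' ≡ rowPS M i j + M i j'
rowPS-step M i j j' = prefixSum-step (M i) j' (toℕ j)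

potential : ∀ {m n} → Matrix m n → Cell m n → ℤ
potential M ext        = + 0
potential M (cell i j) = colPS (rowPS M) i j

crossedEdge : ∀ {m n} {δ : Labeling m n} {c c'} → Adj δ c c' → Edge m n
crossedEdge (right i j j' _ _) = ver i j'
crossedEdge (down i i' j _ _)  = hor i' j
crossedEdge (top i j _ _)      = hor i j
crossedEdge (left i j _ _)     = ver i j

crossedEdge-∉G : ∀ {m n} {δ : Labeling m n} {c c'} (a : Adj δ c c') → ¬ InG δ (crossedEdge a)
crossedEdge-∉G (right _ _ _ _ ∉G) = ∉G
crossedEdge-∉G (down _ _ _ _ ∉G)  = ∉G
crossedEdge-∉G (top _ _ _ ∉G)     = ∉G
crossedEdge-∉G (left _ _ _ ∉G)    = ∉G

potential-cross : ∀ {m n} {δ : Labeling m n} {c c'} (a : Adj δ c c') (M : Matrix m n) →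
  potential M c' ≡ potential M c + gval M (crossedEdge a)
potential-cross (right i j j' j'≡1+j _) M = begin
  colPS (rowPS M) i j'                    ≡⟨ colPS-rowPS-comm M i j' ⟩
  rowPS (colPS M) i j'                    ≡⟨ rowPS-step (colPS M) i j j' j'≡1+j ⟩
  rowPS (colPS M) i j + colPS M i j'      ≡⟨ cong (λ z → z + colPS M i j') (colPS-rowPS-comm M i j) ⟨
  colPS (rowPS M) i j + colPS M i j'      ∎
potential-cross (down i i' j i'≡1+i _) M = colPS-step (rowPS M) i i' j i'≡1+i
potential-cross (top i j i≡0 _) M = begin
  colPS (rowPS M) i j    ≡⟨ colPS-first (rowPS M) i j i≡0 ⟩
  rowPS M i j            ≡⟨ ℤ.+-identityˡ _ ⟨
  + 0 + rowPS M i j      ∎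
potential-cross (left i j j≡0 _) M = begin
  colPS (rowPS M) i j    ≡⟨ colPS-rowPS-comm M i j ⟩
  rowPS (colPS M) i j    ≡⟨ rowPS-first (colPS M) i j j≡0 ⟩
  colPS M i j            ≡⟨ ℤ.+-identityˡ _ ⟨
  + 0 + colPS M i j      ∎

edge-crossing : ∀ {m n} (δ : Labeling m n) (e : Edge m n) → ¬ InG δ e →
  Σ (Cell m n) λ c₁ → Σ (Cell m n) λ c₂ → Σ (Adj δ c₁ c₂) λ a → crossedEdge a ≡ e
edge-crossing δ (hor fzero j) ∉G = _ , _ , top fzero j refl ∉G , refl
edge-crossing δ (hor (fsuc i) j) ∉G =
  _ , _ , down (inject₁ i) (fsuc i) j (cong suc (sym (Fin.toℕ-inject₁ i))) ∉G , refl
edge-crossing δ (ver i fzero) ∉G = _ , _ , left i fzero refl ∉G , refl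
edge-crossing δ (ver i (fsuc j)) ∉G =
  _ , _ , right i (inject₁ j) (fsuc j) (cong suc (sym (Fin.toℕ-inject₁ j))) ∉G , refl

module _ {m n} {δ δ' : Labeling m n} (δ⊆δ' : δ ⊆L δ') where

  InG-mono : ∀ {e} → InG δ e → InG δ' e
  InG-mono = Product.map (δ⊆δ' _ _) (δ⊆δ' _ _)

  Adj-antimono : ∀ {c c'} → Adj δ' c c' → Adj δ c c'
  Adj-antimono (right i j j' eq ∉G) = right i j j' eq (∉G ∘ InG-mono)
  Adj-antimono (down i i' j eq ∉G)  = down i i' j eq (∉G ∘ InG-mono)
  Adj-antimono (top i j eq ∉G)      = top i j eq (∉G ∘ InG-mono)
  Adj-antimono (left i j eq ∉G)     = left i j eq (∉G ∘ InG-mono)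

  SameFace-antimono : ∀ {c c'} → SameFace δ' c c' → SameFace δ c c'
  SameFace-antimono = Star.map (SymClosure.map Adj-antimono)

gval-In01 : ∀ {m n} (P : PASM m n) e → In01 (gval (proj₁ P) e)
gval-In01 (_ , _ , rows , cols) (hor i j) = rows i j
gval-In01 (_ , _ , rows , cols) (ver i j) = cols i j

unionBasic-In01 : ∀ {m n} (Ms : List⁺ (PASM m n)) e x → unionBasic Ms e x → In01 x
unionBasic-In01 Ms e x (P , _ , refl) = gval-In01 P e

unionBasic-dec : ∀ {m n} (Ms : List⁺ (PASM m n)) e x → Dec (unionBasic Ms e x)
unionBasic-dec Ms e x with any? (λ P → x ℤ.≟ gval (proj₁ P) e) (toList Ms)
... | yes some = yes (find some)
... | no  none = no (λ (P , P∈Ms , x≡) → none (lose P∈Ms x≡))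

new-label⇒InG : ∀ {m n} {δ δ' : Labeling m n} {e v x} → δ ⊆L δ' →
  δ e v → In01 v → δ' e x → In01 x → ¬ δ e x → InG δ' e × ¬ InG δ e
new-label⇒InG _   δv (inj₁ refl) _   (inj₁ refl) δ∌x = ⊥-elim (δ∌x δv)
new-label⇒InG sub δv (inj₁ refl) δ'x (inj₂ refl) δ∌x = (sub _ _ δv , δ'x) , δ∌x ∘ proj₂
new-label⇒InG sub δv (inj₂ refl) δ'x (inj₁ refl) δ∌x = (δ'x , sub _ _ δv) , δ∌x ∘ proj₁
new-label⇒InG _   δv (inj₂ refl) _   (inj₂ refl) δ∌x = ⊥-elim (δ∌x δv)

potentialDiff : ∀ {m n} → PASM m n → PASM m n → Cell m n → ℤ
potentialDiff (M₁ , _) (M₂ , _) c = potential M₁ c - potential M₂ c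

[i+k]-[j+k]≡i-j : ∀ i j k → (i + k) - (j + k) ≡ i - j
[i+k]-[j+k]≡i-j = solve-∀

i-j≡1+[[i+0]-[j+1]] : ∀ i j → i - j ≡ + 1 + ((i + + 0) - (j + + 1))
i-j≡1+[[i+0]-[j+1]] = solve-∀

module _ {m n} {δ' : Labeling m n} {Ms' : List⁺ (PASM m n)} (δ'≈Ms' : δ' ≈L unionBasic Ms') where

  ∋-gval : ∀ {P} → P ∈ toList Ms' → ∀ e → δ' e (gval (proj₁ P) e)
  ∋-gval P∈ e = proj₂ δ'≈Ms' e _ (_ , P∈ , refl)

  gval-agree-off-G : ∀ {P₁ P₂} → P₁ ∈ toList Ms' → P₂ ∈ toList Ms' →
    ∀ e → ¬ InG δ' e → gval (proj₁ P₁) e ≡ gval (proj₁ P₂) e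
  gval-agree-off-G {P₁} {P₂} P₁∈ P₂∈ e ∉G with gval-In01 P₁ e | gval-In01 P₂ e
  ... | inj₁ g₁≡0 | inj₁ g₂≡0 = trans g₁≡0 (sym g₂≡0)
  ... | inj₂ g₁≡1 | inj₂ g₂≡1 = trans g₁≡1 (sym g₂≡1)
  ... | inj₁ g₁≡0 | inj₂ g₂≡1 =
    ⊥-elim (∉G (subst (δ' e) g₁≡0 (∋-gval P₁∈ e) , subst (δ' e) g₂≡1 (∋-gval P₂∈ e)))
  ... | inj₂ g₁≡1 | inj₁ g₂≡0 =
    ⊥-elim (∉G (subst (δ' e) g₂≡0 (∋-gval P₂∈ e) , subst (δ' e) g₁≡1 (∋-gval P₁∈ e)))

  module _ {P₁ P₂} (P₁∈ : P₁ ∈ toList Ms') (P₂∈ : P₂ ∈ toList Ms') where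

    potentialDiff-cross : ∀ {c c'} → Adj δ' c c' → potentialDiff P₁ P₂ c' ≡ potentialDiff P₁ P₂ c
    potentialDiff-cross {c} {c'} a = begin
      potential M₁ c' - potential M₂ c'
        ≡⟨ cong₂ _-_ (potential-cross a M₁) (potential-cross a M₂) ⟩
      (potential M₁ c + gval M₁ e) - (potential M₂ c + gval M₂ e)
        ≡⟨ cong (λ z → (potential M₁ c + z) - (potential M₂ c + gval M₂ e))
                (gval-agree-off-G P₁∈ P₂∈ e (crossedEdge-∉G a)) ⟩
      (potential M₁ c + gval M₂ e) - (potential M₂ c + gval M₂ e)
        ≡⟨ [i+k]-[j+k]≡i-j (potential M₁ c) (potential M₂ c) (gval M₂ e) ⟩
      potential M₁ c - potential M₂ c ∎
      where
      M₁ = proj₁ P₁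
      M₂ = proj₁ P₂
      e = crossedEdge a

    potentialDiff-face : ∀ {c c'} → SameFace δ' c c' → potentialDiff P₁ P₂ c ≡ potentialDiff P₁ P₂ c'
    potentialDiff-face ε             = refl
    potentialDiff-face (fwd a ◅ path) = trans (sym (potentialDiff-cross a)) (potentialDiff-face path)
    potentialDiff-face (bwd a ◅ path) = trans (potentialDiff-cross a) (potentialDiff-face path)

  InG-separates : ∀ {δ : Labeling m n} {c₁ c₂} (a : Adj δ c₁ c₂) →
    InG δ' (crossedEdge a) → ¬ SameFace δ' c₁ c₂
  InG-separates {c₁ = c₁} {c₂} a (δ'∋0 , δ'∋1) same
    with proj₁ δ'≈Ms' _ _ δ'∋0 | proj₁ δ'≈Ms' _ _ δ'∋1
  ... | P₀ , P₀∈ , 0≡g₀ | P₁ , P₁∈ , 1≡g₁ = ℤ.i≢suc[i] (begin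
    D c₂
      ≡⟨ potentialDiff-face P₀∈ P₁∈ same ⟨
    potential M₀ c₁ - potential M₁ c₁
      ≡⟨ i-j≡1+[[i+0]-[j+1]] (potential M₀ c₁) (potential M₁ c₁) ⟩
    + 1 + ((potential M₀ c₁ + + 0) - (potential M₁ c₁ + + 1))
      ≡⟨ cong (_+_ (+ 1)) (cong₂ _-_ (cong (_+_ (potential M₀ c₁)) 0≡g₀)
                                     (cong (_+_ (potential M₁ c₁)) 1≡g₁)) ⟩
    + 1 + ((potential M₀ c₁ + gval M₀ e) - (potential M₁ c₁ + gval M₁ e))
      ≡⟨ cong (_+_ (+ 1)) (cong₂ _-_ (potential-cross a M₀) (potential-cross a M₁)) ⟨
    + 1 + D c₂ ∎)
    where
    M₀ = proj₁ P₀
    M₁ = proj₁ P₁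
    e = crossedEdge a
    D = potentialDiff P₀ P₁

injective-avoiding⇒< : ∀ {a b} {h : Fin (suc a) → Fin (suc b)} → Injective _≡_ _≡_ h →
  (p : Fin (suc b)) → (∀ z → p ≢ h z) → a ℕ.< b
injective-avoiding⇒< h-inj p p∉h = Fin.injective⇒≤ {f = g} g-inj
  where
  g : _ → _
  g z = punchOut (p∉h z)
  g-inj : Injective _≡_ _≡_ g
  g-inj = h-inj ∘ Fin.punchOut-injective (p∉h _) (p∉h _)

module _ {C : Set} {k k'} (f : C → Fin (suc k)) (f' : C → Fin (suc k'))
         (f-surj : ∀ y → ∃ λ c → f c ≡ y) (refines : ∀ c c' → f' c ≡ f' c' → f c ≡ f c') where

  private
    rep : Fin (suc k) → C
    rep z = proj₁ (f-surj z)

    f'∘rep : Fin (suc k) → Fin (suc k')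
    f'∘rep = f' ∘ rep

    f'∘rep-fiber : ∀ z c → f'∘rep z ≡ f' c → z ≡ f c
    f'∘rep-fiber z c eq = trans (sym (proj₂ (f-surj z))) (refines (rep z) c eq)

    f'∘rep-inj : Injective _≡_ _≡_ f'∘rep
    f'∘rep-inj {z₁} {z₂} eq = trans (f'∘rep-fiber z₁ (rep z₂) eq) (proj₂ (f-surj z₂))

  strict-refinement⇒< : ∀ c₁ c₂ → f c₁ ≡ f c₂ → f' c₁ ≢ f' c₂ → k ℕ.< k'
  -- f'∘rep embeds the classes of f into those of f' and misses f' c₁ or f' c₂.
  strict-refinement⇒< c₁ c₂ fc₁≡fc₂ f'c₁≢f'c₂ with f'∘rep (f c₁) Fin.≟ f' c₁
  ... | yes hit = injective-avoiding⇒< f'∘rep-inj (f' c₂) λ z f'c₂≡ →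
          f'c₁≢f'c₂ (begin
            f' c₁          ≡⟨ hit ⟨
            f'∘rep (f c₁)  ≡⟨ cong f'∘rep (trans fc₁≡fc₂ (sym (f'∘rep-fiber z c₂ (sym f'c₂≡)))) ⟩
            f'∘rep z       ≡⟨ f'c₂≡ ⟨
            f' c₂          ∎)
  ... | no miss = injective-avoiding⇒< f'∘rep-inj (f' c₁) λ z f'c₁≡ →
          miss (subst (λ y → f'∘rep y ≡ f' c₁) (f'∘rep-fiber z c₁ (sym f'c₁≡)) (sym f'c₁≡))

faces-grow-at-new-label : ∀ {m n} {δ δ' : Labeling m n} {Ms Ms' k k'} →
  δ ≈L unionBasic Ms → δ' ≈L unionBasic Ms' → δ ⊆L δ' → HasFaces δ k → HasFaces δ' k' →
  ∀ {e x} → δ' e x → ¬ δ e x → k ℕ.< k'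
faces-grow-at-new-label {δ = δ} {Ms = P ∷ _} {Ms'} δ≈Ms δ'≈Ms' δ⊆δ'
  (f , f-surj , f-faces) (f' , _ , f'-faces) {e} {x} δ'x δ∌x
  with new-label⇒InG δ⊆δ' (proj₂ δ≈Ms e _ (P , here refl , refl)) (gval-In01 P e)
                     δ'x (unionBasic-In01 Ms' e x (proj₁ δ'≈Ms' e x δ'x)) δ∌x
... | e∈G' , e∉G with edge-crossing δ e e∉G
... | c₁ , c₂ , a , refl =
  strict-refinement⇒< f f' f-surj
    (λ c c' → proj₂ (f-faces c c') ∘ SameFace-antimono δ⊆δ' ∘ proj₁ (f'-faces c c'))
    c₁ c₂ (proj₂ (f-faces c₁ c₂) (fwd a ◅ ε))
    (InG-separates δ'≈Ms' a e∈G' ∘ proj₁ (f'-faces c₁ c₂))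

faces-grow : ∀ {m n} {δ δ' : Labeling m n} {Ms Ms' k k'} →
  δ ≈L unionBasic Ms → δ' ≈L unionBasic Ms' → δ ⊊L δ' → HasFaces δ k → HasFaces δ' k' → k ℕ.< k'
faces-grow {Ms = Ms} δ≈Ms δ'≈Ms' (δ⊆δ' , δ≉δ') Fδ Fδ' = decidable-stable (_ ℕ.<? _) λ k≮k' →
  δ≉δ' (δ⊆δ' , λ e x δ'x → proj₂ δ≈Ms e x (decidable-stable (unionBasic-dec Ms e x) λ x∉Ms →
    k≮k' (faces-grow-at-new-label δ≈Ms δ'≈Ms' δ⊆δ' Fδ Fδ' δ'x (x∉Ms ∘ proj₁ δ≈Ms e x))))

⊆L-emptyLab : ∀ {m n} {δ δ' : Labeling m n} → δ ⊆L δ' → δ' ≈L emptyLab → δ ≈L emptyLab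
⊆L-emptyLab δ⊆δ' (δ'⊆∅ , _) = (λ e x → δ'⊆∅ e x ∘ δ⊆δ' e x) , λ _ _ ()

⊊L⇒≉emptyLab : ∀ {m n} {δ δ' : Labeling m n} → δ ⊊L δ' → ¬ δ' ≈L emptyLab
⊊L⇒≉emptyLab (δ⊆δ' , δ≉δ') (δ'⊆∅ , _) = δ≉δ' (δ⊆δ' , λ e x → ⊥-elim ∘ δ'⊆∅ e x)

nonempty-sumLabeling⇒union : ∀ {m n} {δ : Labeling m n} → IsSumLabeling δ → ¬ δ ≈L emptyLab →
  Σ (List⁺ (PASM m n)) λ Ms → δ ≈L unionBasic Ms
nonempty-sumLabeling⇒union (inj₁ δ≈∅)  δ≉∅ = ⊥-elim (δ≉∅ δ≈∅)
nonempty-sumLabeling⇒union (inj₂ union) _   = union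

lemma4p16 : (m n : ℕ) → 1 ≤ m → 1 ≤ n → (δ δ' : Labeling m n)
            → IsSumLabeling δ → IsSumLabeling δ' → δ ⊊L δ'
            → (ω : ℤ) → RegionCount δ ω
            → (ω' : ℤ) → RegionCount δ' ω' → ω < ω'
lemma4p16 m n _ _ δ δ' _ _ δ⊊δ' ω (inj₁ (_ , refl)) ω' (inj₁ (δ'≈∅ , _)) =
  ⊥-elim (⊊L⇒≉emptyLab δ⊊δ' δ'≈∅)
lemma4p16 m n _ _ δ δ' _ _ _ ω (inj₁ (_ , refl)) ω' (inj₂ (_ , _ , refl , _)) = -<+
lemma4p16 m n _ _ δ δ' _ _ (δ⊆δ' , _) ω (inj₂ (δ≉∅ , _)) ω' (inj₁ (δ'≈∅ , _)) =
  ⊥-elim (δ≉∅ (⊆L-emptyLab δ⊆δ' δ'≈∅))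
lemma4p16 m n _ _ δ δ' sδ sδ' δ⊊δ' ω (inj₂ (δ≉∅ , k , refl , Fδ)) ω' (inj₂ (δ'≉∅ , k' , refl , Fδ')) =
  +<+ (faces-grow (proj₂ (nonempty-sumLabeling⇒union sδ δ≉∅))
                  (proj₂ (nonempty-sumLabeling⇒union sδ' δ'≉∅)) δ⊊δ' Fδ Fδ')
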